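{- For each integer $m\ge 1$ let $C_m=\det C^{(m)}$, where $C^{(m)}$ is the $m\times m$ matrix with entries $C^{(m)}_{ij}=1$ if $-2\le j-i\le 1$ and $0$ otherwise. Let $a\in\mathbb{R}$ and let $n\ge 3$ be an integer. Let $G^{(n)}$ be the $n\times n$ matrix whose first row has $G^{(n)}_{11}=G^{(n)}_{12}=1$, $G^{(n)}_{1n}=a$ and all other entries $0$, and whose rows $i=2,\dots,n$ have $G^{(n)}_{ij}=1$ if $-1\le j-i\le 2$ and $0$ otherwise. Let $G_n=\det G^{(n)}$. Then $$G_n = C_{n-1} - C_{n-2} + a(-1)^{n+1}.$$ -}

module Defs where

open import Level using (Level)
open import Algebra.Bundles using (CommutativeRing)
open import Data.Nat using (ℕ; zero; suc; _∸_; _≤ᵇ_)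
open import Data.Fin using (Fin; zero; suc; toℕ; punchIn)
open import Data.Bool using (Bool; true; false; if_then_else_; _∧_)
open import Data.Nat using () renaming (_≡ᵇ_ to _==_)

-- Everything is over an arbitrary commutative ring R (the paper uses ℝ).
module Det {c ℓ : Level} (R : CommutativeRing c ℓ) where
  open CommutativeRing R hiding (zero)

  Matrix : ℕ → Set c
  Matrix n = Fin n → Fin n → Carrier

  altSum : ∀ {n} → (Fin n → Carrier) → Carrier
  altSum {zero}  f = 0#
  altSum {suc n} f = f zero - altSum (λ j → f (suc j))

  minor : ∀ {n} → Matrix (suc n) → Fin (suc n) → Matrix n
  minor M j i k = M (suc i) (punchIn j k)

  det : ∀ n → Matrix n → Carrier
  det zero    M = 1#
  det (suc n) M = altSum (λ j → M zero j * det n (minor M j))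

  signPow : ℕ → Carrier
  signPow zero    = 1#
  signPow (suc k) = - signPow k

  bool : Bool → Carrier
  bool true  = 1#
  bool false = 0#

  -- C^(m)_{ij} = 1 iff -2 ≤ j - i ≤ 1   (i, j 0-based; differences unchanged)
  Cmat : ∀ m → Matrix m
  Cmat m i j = bool ((toℕ i ≤ᵇ suc (suc (toℕ j))) ∧ (toℕ j ≤ᵇ suc (toℕ i)))

  C : ℕ → Carrier
  C m = det m (Cmat m)

  -- G^(n): first row (index 0) has entries 1 at columns 0,1, a at column n-1,
  -- 0 elsewhere; rows i ≥ 1 have 1 iff -1 ≤ j - i ≤ 2.
  Gmat : Carrier → ∀ n → Matrix n
  Gmat a n zero j =
    if (toℕ j ≤ᵇ 1) then 1# else (if (toℕ j == (n ∸ 1)) then a else 0#)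
  Gmat a n (suc i) j =
    bool ((toℕ (suc i) ≤ᵇ suc (toℕ j)) ∧ (toℕ j ≤ᵇ suc (suc (toℕ (suc i)))))

  G : Carrier → ℕ → Carrier
  G a n = det n (Gmat a n)

-- Every matrix in the argument is a 0/1 "pattern" matrix
-- i,j ↦ b i j, and deleting row 0 and column j of a pattern matrix gives the
-- pattern matrix of a pattern 'minorP j b'.  Expanding G^(n) along its first
-- row, only columns 0, 1 and n-1 contribute: the minor at column n-1 is upper
-- unitriangular, giving a(-1)^(n+1), and the minors at columns 0 and 1 are
-- D_{n-1} and E_{n-1}, where D^(k) is the transposed band (1 iff
-- -1 ≤ j-i ≤ 2) and E^(k) is D^(k) with entry (1,0) cleared.
-- It remains to identify D_k = C_k and E_{k+1} = C_k.  First-row expansion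
-- gives two closed systems of recurrences for C and D together with four
-- auxiliary band patterns X, Y (from C) and E, F (from D):
--     C' = C - X,  X' = C - Y,  Y' = C      and      D' = D - E + F,  E' = D,  F' = E,
-- and the invariant  D = C,  E = Y,  X = E - F  is preserved by them; it
-- holds at size 2, hence D_k = C_k for every k.
module Submission where

open import Defs
open import Level using (Level)
open import Algebra.Bundles using (CommutativeRing)
open import Data.Nat as ℕ using (ℕ; _≤_; _∸_; suc; zero; _<_; _≤ᵇ_; s≤s; z<s) renaming (_≡ᵇ_ to _==_)
open import Data.Fin using (Fin; zero; suc; toℕ; punchIn; fromℕ; inject₁)
open import Data.Bool using (Bool; true; false; _∧_; if_then_else_)
open import Relation.Binary.PropositionalEquality as ≡ using (_≡_)

Pattern : Set
Pattern = ℕ → ℕ → Bool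

_≐_ : Pattern → Pattern → Set
b ≐ b′ = ∀ i j → b i j ≡ b′ i j

≤ᵇ-suc : ∀ m n → (suc m ≤ᵇ suc n) ≡ (m ≤ᵇ n)
≤ᵇ-suc zero    n = ≡.refl
≤ᵇ-suc (suc m) n = ≡.refl

ShiftInvariant : Pattern → Set
ShiftInvariant b = ∀ i j → b (suc i) (suc j) ≡ b i j

shift-iterate : ∀ {b} → ShiftInvariant b → ∀ d i j → b (d ℕ.+ i) (d ℕ.+ j) ≡ b i j
shift-iterate shift zero    i j = ≡.refl
shift-iterate shift (suc d) i j = ≡.trans (shift (d ℕ.+ i) (d ℕ.+ j)) (shift-iterate shift d i j)

cBand : Pattern
cBand i j = (i ≤ᵇ suc (suc j)) ∧ (j ≤ᵇ suc i)

-- Its transpose:  1 iff -1 ≤ j - i ≤ 2; rows 2..n of G^(n) follow it.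
dBand : Pattern
dBand i j = (i ≤ᵇ suc j) ∧ (j ≤ᵇ suc (suc i))

cBand-shift : ShiftInvariant cBand
cBand-shift i j = ≡.cong₂ _∧_ (≤ᵇ-suc i (suc (suc j))) (≤ᵇ-suc j (suc i))

dBand-shift : ShiftInvariant dBand
dBand-shift i j = ≡.cong₂ _∧_ (≤ᵇ-suc i (suc j)) (≤ᵇ-suc j (suc (suc i)))

punchInℕ : ℕ → ℕ → ℕ
punchInℕ zero    k       = suc k
punchInℕ (suc j) zero    = zero
punchInℕ (suc j) (suc k) = suc (punchInℕ j k)

toℕ-punchIn : ∀ {n} (j : Fin (suc n)) (k : Fin n) → toℕ (punchIn j k) ≡ punchInℕ (toℕ j) (toℕ k)
toℕ-punchIn zero    k       = ≡.refl
toℕ-punchIn (suc j) zero    = ≡.refl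
toℕ-punchIn (suc j) (suc k) = ≡.cong suc (toℕ-punchIn j k)

toℕ-punchIn-last : ∀ n (k : Fin n) → toℕ (punchIn (fromℕ n) k) ≡ toℕ k
toℕ-punchIn-last (suc n) zero    = ≡.refl
toℕ-punchIn-last (suc n) (suc k) = ≡.cong suc (toℕ-punchIn-last n k)

minorP : ℕ → Pattern → Pattern
minorP j b i k = b (suc i) (punchInℕ j k)

-- The auxiliary band patterns of the recurrences: X is C with entry (2,0)
-- cleared, Y is C with (1,0) and (2,0) cleared, E is D with (1,0) cleared and
-- F is D with (1,0) and (2,1) cleared.
xBand yBand eBand fBand : Pattern
xBand = minorP 1 cBand
yBand = minorP 1 xBand
eBand = minorP 1 dBand
fBand = minorP 2 dBand

minor₀-xBand : minorP 0 xBand ≐ cBand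
minor₀-xBand = shift-iterate cBand-shift 2

minor₀-yBand : minorP 0 yBand ≐ cBand
minor₀-yBand = shift-iterate cBand-shift 3

minor₀-eBand : minorP 0 eBand ≐ dBand
minor₀-eBand = shift-iterate dBand-shift 2

minor₀-fBand : minorP 0 fBand ≐ eBand
minor₀-fBand i k = dBand-shift (suc i) (punchInℕ 1 k)

-- The matrix i,k ↦ dBand (i+1) k (the last minor of G^(n)) is upper
-- unitriangular.
dBand-below : ∀ {i k} → k < i → dBand (suc i) k ≡ false
dBand-below {suc i} {zero}  _         = ≡.refl
dBand-below {suc i} {suc k} (s≤s k<i) = ≡.trans (dBand-shift (suc i) k) (dBand-below k<i)

dBand-diagonal : ∀ i → dBand (suc i) i ≡ true
dBand-diagonal zero    = ≡.refl
dBand-diagonal (suc i) = ≡.trans (dBand-shift (suc i) i) (dBand-diagonal i)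

inject₁-≢-last : ∀ {m} (k : Fin m) → (toℕ (inject₁ k) == m) ≡ false
inject₁-≢-last zero    = ≡.refl
inject₁-≢-last (suc k) = inject₁-≢-last k

fromℕ-≡-last : ∀ m → (toℕ (fromℕ m) == m) ≡ true
fromℕ-≡-last zero    = ≡.refl
fromℕ-≡-last (suc m) = fromℕ-≡-last m

module BandDeterminants {c ℓ : Level} (R : CommutativeRing c ℓ) where
  open CommutativeRing R hiding (zero)
  open Det R
  open import Algebra.Properties.Ring ring using (-‿distribˡ-*; -‿+-comm; -‿involutive; -0#≈0#)
  open import Relation.Binary.Reasoning.Setoid setoid

  sub-cong : ∀ {x x′ y y′} → x ≈ x′ → y ≈ y′ → x - y ≈ x′ - y′
  sub-cong p q = +-cong p (-‿cong q)

  x-0≈x : ∀ x → x - 0# ≈ x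
  x-0≈x x = trans (+-congˡ -0#≈0#) (+-identityʳ x)

  x-[y-z]≈x-y+z : ∀ x y z → x - (y - z) ≈ (x - y) + z
  x-[y-z]≈x-y+z x y z = begin
    x + - (y + - z)      ≈⟨ +-congˡ (sym (-‿+-comm y (- z))) ⟩
    x + (- y + - - z)    ≈⟨ +-congˡ (+-congˡ (-‿involutive z)) ⟩
    x + (- y + z)        ≈⟨ sym (+-assoc x (- y) z) ⟩
    (x - y) + z          ∎

  altSum-cong : ∀ {n} {f g : Fin n → Carrier} → (∀ j → f j ≈ g j) → altSum f ≈ altSum g
  altSum-cong {zero}  f≈g = refl
  altSum-cong {suc n} f≈g = sub-cong (f≈g zero) (altSum-cong (λ j → f≈g (suc j)))

  altSum-zero : ∀ {n} {f : Fin n → Carrier} → (∀ j → f j ≈ 0#) → altSum f ≈ 0#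
  altSum-zero {zero}  f≈0 = refl
  altSum-zero {suc n} f≈0 = trans (sub-cong (f≈0 zero) (altSum-zero (λ j → f≈0 (suc j)))) (-‿inverseʳ 0#)

  altSum-last : ∀ m (f : Fin (suc m) → Carrier) → (∀ k → f (inject₁ k) ≈ 0#) →
                altSum f ≈ signPow m * f (fromℕ m)
  altSum-last zero    f f≈0 = trans (x-0≈x _) (sym (*-identityˡ _))
  altSum-last (suc m) f f≈0 = begin
    f zero - altSum (λ j → f (suc j))   ≈⟨ sub-cong (f≈0 zero) (altSum-last m (λ j → f (suc j)) (λ k → f≈0 (suc k))) ⟩
    0# - signPow m * f (fromℕ (suc m))  ≈⟨ +-identityˡ _ ⟩
    - (signPow m * f (fromℕ (suc m)))   ≈⟨ -‿distribˡ-* _ _ ⟩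
    signPow (suc m) * f (fromℕ (suc m)) ∎

  det-cong : ∀ n {M N : Matrix n} → (∀ i j → M i j ≈ N i j) → det n M ≈ det n N
  det-cong zero    M≈N = refl
  det-cong (suc n) M≈N =
    altSum-cong (λ j → *-cong (M≈N zero j) (det-cong n (λ i k → M≈N (suc i) (punchIn j k))))

  Mat : Pattern → ∀ n → Matrix n
  Mat b n i j = bool (b (toℕ i) (toℕ j))

  detP : Pattern → ℕ → Carrier
  detP b n = det n (Mat b n)

  detP-cong : ∀ {b b′} → b ≐ b′ → ∀ n → detP b n ≈ detP b′ n
  detP-cong b≐b′ n = det-cong n (λ i j → reflexive (≡.cong bool (b≐b′ (toℕ i) (toℕ j))))

  bool-true : ∀ {t} → t ≡ true → ∀ x → bool t * x ≈ x
  bool-true ≡.refl x = *-identityˡ x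

  bool-false : ∀ {t} → t ≡ false → ∀ x → bool t * x ≈ 0#
  bool-false ≡.refl x = zeroˡ x

  det-minor : ∀ b n (j : Fin (suc n)) → det n (minor (Mat b (suc n)) j) ≈ detP (minorP (toℕ j) b) n
  det-minor b n j = det-cong n (λ i k → reflexive (≡.cong (λ x → bool (b (suc (toℕ i)) x)) (toℕ-punchIn j k)))

  det-lastMinor : ∀ b n → det n (minor (Mat b (suc n)) (fromℕ n)) ≈ detP (λ i k → b (suc i) k) n
  det-lastMinor b n = det-cong n (λ i k → reflexive (≡.cong (λ x → bool (b (suc (toℕ i)) x)) (toℕ-punchIn-last n k)))

  detP-expand : ∀ b n → detP b (suc n) ≈ altSum {suc n} (λ j → bool (b 0 (toℕ j)) * detP (minorP (toℕ j) b) n)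
  detP-expand b n = altSum-cong {suc n} (λ j → *-congˡ {bool (b 0 (toℕ j))} (det-minor b n j))

  -- A pattern matrix whose first column vanishes has determinant 0: every
  -- minor after the first again has a vanishing first column.
  detP-zeroColumn : ∀ b n → (∀ i → b i 0 ≡ false) → detP b (suc n) ≈ 0#
  detP-zeroColumn b n col≡0 = trans (detP-expand b n) (altSum-zero (term n))
    where
    term : ∀ n (j : Fin (suc n)) → bool (b 0 (toℕ j)) * detP (minorP (toℕ j) b) n ≈ 0#
    term n       zero    = bool-false (col≡0 0) _
    term (suc n) (suc j) = trans (*-congˡ (detP-zeroColumn (minorP (suc (toℕ j)) b) n (λ i → col≡0 (suc i)))) (zeroʳ _)

  detP-unitColumn : ∀ b n → b 0 0 ≡ true → (∀ i → b (suc i) 0 ≡ false) → detP b (suc n) ≈ detP (minorP 0 b) n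
  detP-unitColumn b n top≡1 below≡0 = begin
    detP b (suc n)
      ≈⟨ detP-expand b n ⟩
    bool (b 0 0) * detP (minorP 0 b) n - altSum {n} (λ j → bool (b 0 (suc (toℕ j))) * detP (minorP (suc (toℕ j)) b) n)
      ≈⟨ sub-cong (bool-true top≡1 _) (altSum-zero (term n)) ⟩
    detP (minorP 0 b) n - 0#
      ≈⟨ x-0≈x _ ⟩
    detP (minorP 0 b) n
      ∎
    where
    term : ∀ n (j : Fin n) → bool (b 0 (suc (toℕ j))) * detP (minorP (suc (toℕ j)) b) n ≈ 0#
    term (suc n) j = trans (*-congˡ (detP-zeroColumn (minorP (suc (toℕ j)) b) n below≡0)) (zeroʳ _)

  detP-unitriangular : ∀ b → (∀ {i k} → k < i → b i k ≡ false) → (∀ i → b i i ≡ true) →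
                       ∀ n → detP b n ≈ 1#
  detP-unitriangular b below diag zero    = refl
  detP-unitriangular b below diag (suc n) = trans (detP-unitColumn b n (diag 0) (λ i → below z<s))
    (detP-unitriangular (minorP 0 b) (λ k<i → below (s≤s k<i)) (λ i → diag (suc i)) n)

  detP-expand-110 : ∀ b n → b 0 0 ≡ true → b 0 1 ≡ true → (∀ j → b 0 (2 ℕ.+ j) ≡ false) →
                    detP b (2 ℕ.+ n) ≈ detP (minorP 0 b) (1 ℕ.+ n) - detP (minorP 1 b) (1 ℕ.+ n)
  detP-expand-110 b n b₀₀ b₀₁ rest≡0 =
    trans (detP-expand b (1 ℕ.+ n))
      (sub-cong (bool-true b₀₀ _)
        (trans (sub-cong (bool-true b₀₁ _) (altSum-zero {n} (λ j → bool-false (rest≡0 (toℕ j)) _))) (x-0≈x _)))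

  detP-expand-111 : ∀ b n → b 0 0 ≡ true → b 0 1 ≡ true → b 0 2 ≡ true → (∀ j → b 0 (3 ℕ.+ j) ≡ false) →
                    detP b (3 ℕ.+ n) ≈ (detP (minorP 0 b) (2 ℕ.+ n) - detP (minorP 1 b) (2 ℕ.+ n)) + detP (minorP 2 b) (2 ℕ.+ n)
  detP-expand-111 b n b₀₀ b₀₁ b₀₂ rest≡0 =
    trans (detP-expand b (2 ℕ.+ n))
      (trans (sub-cong (bool-true b₀₀ _) (sub-cong (bool-true b₀₁ _)
               (trans (sub-cong (bool-true b₀₂ _) (altSum-zero {n} (λ j → bool-false (rest≡0 (toℕ j)) _))) (x-0≈x _))))
             (x-[y-z]≈x-y+z _ _ _))

  X Y D E F : ℕ → Carrier
  X = detP xBand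
  Y = detP yBand
  D = detP dBand
  E = detP eBand
  F = detP fBand

  C-rec : ∀ n → C (2 ℕ.+ n) ≈ C (1 ℕ.+ n) - X (1 ℕ.+ n)
  C-rec n = trans (detP-expand-110 cBand n ≡.refl ≡.refl (λ _ → ≡.refl)) (sub-cong (detP-cong cBand-shift (1 ℕ.+ n)) refl)

  X-rec : ∀ n → X (2 ℕ.+ n) ≈ C (1 ℕ.+ n) - Y (1 ℕ.+ n)
  X-rec n = trans (detP-expand-110 xBand n ≡.refl ≡.refl (λ _ → ≡.refl)) (sub-cong (detP-cong minor₀-xBand (1 ℕ.+ n)) refl)

  Y-rec : ∀ n → Y (suc n) ≈ C n
  Y-rec n = trans (detP-unitColumn yBand n ≡.refl (λ _ → ≡.refl)) (detP-cong minor₀-yBand n)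

  D-rec : ∀ n → D (3 ℕ.+ n) ≈ (D (2 ℕ.+ n) - E (2 ℕ.+ n)) + F (2 ℕ.+ n)
  D-rec n = trans (detP-expand-111 dBand n ≡.refl ≡.refl ≡.refl (λ _ → ≡.refl))
                  (+-congʳ (sub-cong (detP-cong dBand-shift (2 ℕ.+ n)) refl))

  E-rec : ∀ n → E (suc n) ≈ D n
  E-rec n = trans (detP-unitColumn eBand n ≡.refl (λ _ → ≡.refl)) (detP-cong minor₀-eBand n)

  F-rec : ∀ n → F (suc n) ≈ E n
  F-rec n = trans (detP-unitColumn fBand n ≡.refl (λ _ → ≡.refl)) (detP-cong minor₀-fBand n)

  record Simulation (k : ℕ) : Set ℓ where
    field
      D≈C   : D k ≈ C k
      E≈Y   : E k ≈ Y k
      X≈E-F : X k ≈ E k - F k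

  -- At size 2, D and C (and E and Y) are the same matrix, and
  -- X_2 = C_1 - Y_1 is literally D_1 - E_1 = E_2 - F_2.
  simulation-base : Simulation 2
  simulation-base = record
    { D≈C   = refl
    ; E≈Y   = refl
    ; X≈E-F = trans (X-rec 0) (sym (sub-cong (E-rec 1) (F-rec 1)))
    }

  simulation-step : ∀ n → Simulation (2 ℕ.+ n) → Simulation (3 ℕ.+ n)
  simulation-step n sim = record
    { D≈C   = begin
        D (3 ℕ.+ n)                                  ≈⟨ D-rec n ⟩
        (D (2 ℕ.+ n) - E (2 ℕ.+ n)) + F (2 ℕ.+ n)    ≈⟨ sym (x-[y-z]≈x-y+z _ _ _) ⟩
        D (2 ℕ.+ n) - (E (2 ℕ.+ n) - F (2 ℕ.+ n))    ≈⟨ sub-cong D≈C (sym X≈E-F) ⟩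
        C (2 ℕ.+ n) - X (2 ℕ.+ n)                    ≈⟨ sym (C-rec (suc n)) ⟩
        C (3 ℕ.+ n)                                  ∎
    ; E≈Y   = trans (E-rec (2 ℕ.+ n)) (trans D≈C (sym (Y-rec (2 ℕ.+ n))))
    ; X≈E-F = begin
        X (3 ℕ.+ n)                ≈⟨ X-rec (suc n) ⟩
        C (2 ℕ.+ n) - Y (2 ℕ.+ n)  ≈⟨ sub-cong (sym D≈C) (sym E≈Y) ⟩
        D (2 ℕ.+ n) - E (2 ℕ.+ n)  ≈⟨ sym (sub-cong (E-rec (2 ℕ.+ n)) (F-rec (2 ℕ.+ n))) ⟩
        E (3 ℕ.+ n) - F (3 ℕ.+ n)  ∎
    }
    where open Simulation sim

  simulation : ∀ n → Simulation (2 ℕ.+ n)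
  simulation zero    = simulation-base
  simulation (suc n) = simulation-step n (simulation n)

  D≈C : ∀ n → D n ≈ C n
  D≈C zero          = refl
  D≈C (suc zero)    = refl
  D≈C (suc (suc n)) = Simulation.D≈C (simulation n)

  E≈C : ∀ n → E (suc n) ≈ C n
  E≈C n = trans (E-rec n) (D≈C n)

  G-expand : ∀ a m → G a (3 ℕ.+ m) ≈ (D (2 ℕ.+ m) - E (2 ℕ.+ m)) + signPow m * a
  G-expand a m = begin
    G a (3 ℕ.+ m)
      ≈⟨ sub-cong (*-identityˡ _) (sub-cong (*-identityˡ _) lastColumn) ⟩
    det (2 ℕ.+ m) (minor (Mat dBand (3 ℕ.+ m)) zero)
      - (det (2 ℕ.+ m) (minor (Mat dBand (3 ℕ.+ m)) (suc zero)) - signPow m * a)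
      ≈⟨ sub-cong (trans (det-minor dBand (2 ℕ.+ m) zero) (detP-cong dBand-shift (2 ℕ.+ m)))
                  (sub-cong (det-minor dBand (2 ℕ.+ m) (suc zero)) refl) ⟩
    D (2 ℕ.+ m) - (E (2 ℕ.+ m) - signPow m * a)
      ≈⟨ x-[y-z]≈x-y+z _ _ _ ⟩
    (D (2 ℕ.+ m) - E (2 ℕ.+ m)) + signPow m * a
      ∎
    where
    term : Fin (suc m) → Carrier
    term k = Gmat a (3 ℕ.+ m) zero (suc (suc k)) * det (2 ℕ.+ m) (minor (Gmat a (3 ℕ.+ m)) (suc (suc k)))

    lastMinor≈1 : det (2 ℕ.+ m) (minor (Gmat a (3 ℕ.+ m)) (fromℕ (2 ℕ.+ m))) ≈ 1#
    lastMinor≈1 = trans (det-lastMinor dBand (2 ℕ.+ m))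
                        (detP-unitriangular (λ i k → dBand (suc i) k) dBand-below dBand-diagonal (2 ℕ.+ m))

    lastColumn : altSum term ≈ signPow m * a
    lastColumn = begin
      altSum term
        ≈⟨ altSum-last m term (λ k → trans (*-congʳ (reflexive (≡.cong (λ t → if t then a else 0#) (inject₁-≢-last k)))) (zeroˡ _)) ⟩
      signPow m * term (fromℕ m)
        ≈⟨ *-congˡ (*-cong (reflexive (≡.cong (λ t → if t then a else 0#) (fromℕ-≡-last m))) lastMinor≈1) ⟩
      signPow m * (a * 1#)
        ≈⟨ *-congˡ (*-identityʳ a) ⟩
      signPow m * a
        ∎

  signPow-period : ∀ m → signPow (4 ℕ.+ m) ≈ signPow m
  signPow-period m = trans (-‿involutive _) (-‿involutive _)

lemma4 : ∀ {c ℓ : Level} (R : CommutativeRing c ℓ) (a : CommutativeRing.Carrier R) (n : ℕ) → 3 ≤ n →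
    let open CommutativeRing R in let open Det R in
    G a n ≈ (C (n ∸ 1) - C (n ∸ 2)) + a * signPow (suc n)
lemma4 R a (suc (suc (suc m))) (s≤s (s≤s (s≤s _))) = begin
  G a (3 ℕ.+ m)
    ≈⟨ G-expand a m ⟩
  (D (2 ℕ.+ m) - E (2 ℕ.+ m)) + signPow m * a
    ≈⟨ +-cong (sub-cong (D≈C (2 ℕ.+ m)) (E≈C (1 ℕ.+ m))) (*-comm _ a) ⟩
  (C (2 ℕ.+ m) - C (1 ℕ.+ m)) + a * signPow m
    ≈⟨ +-congˡ (*-congˡ (sym (signPow-period m))) ⟩
  (C (2 ℕ.+ m) - C (1 ℕ.+ m)) + a * signPow (4 ℕ.+ m)
    ∎
  where
  open CommutativeRing R hiding (zero)
  open Det R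
  open BandDeterminants R
  open import Relation.Binary.Reasoning.Setoid setoid
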